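{- Let $X$ be a nonempty set of choice functions for $L$. Then $\sim_X$ is logically closed if and only if every $f\in X$ is regular.
   Context: Let $L$ be the propositional language with atoms $p_0,p_1,\ldots$ and connectives $\neg,\wedge$ (others defined as usual); $L_s$ adds a primitive binary connective $|$. $\sim$ denotes classical logical equivalence of $L$-sentences. A truth assignment $M$ is a classical valuation of $Sen(L)$. A choice function for $L$ is a map $f$ assigning to each set $\{\alpha,\beta\}$ of $L$-sentences (possibly $\alpha=\beta$) an element $f(\alpha,\beta)\in\{\alpha,\beta\}$; it is regular if $\alpha\sim\alpha'$ implies $f(\alpha,\beta)\sim f(\alpha',\beta)$ for all $\alpha,\alpha',\beta\in Sen(L)$. Each $f$ induces $\overline f:Sen(L_s)\to Sen(L)$: $\overline f(\alpha)=\alpha$ for classical $\alpha$, $\overline f$ commutes with $\neg,\wedge$, and $\overline f(\varphi|\psi)=f(\overline f(\varphi),\overline f(\psi))$. $\langle M,f\rangle\models_s\varphi$ iff $M\models\overline f(\varphi)$. $\varphi\sim_X\psi$ means: for every $M$ and every $f\in X$, $\langle M,f\rangle\models_s\varphi\iff\langle M,f\rangle\models_s\psi$. For $\varphi\in Sen(L_s)$, $Sub(\varphi)$ is the set of subsentences of $\varphi$, and $\varphi[\sigma'/\sigma]$ is the result of replacing $\sigma$ by $\sigma'$ throughout $\varphi$. $\sim_X$ is logically closed if for all $\varphi$, all $\sigma\in Sub(\varphi)$ and all $\sigma'$: $\sigma\sim_X\sigma'$ implies $\varphi\sim_X\varphi[\sigma'/\sigma]$. -}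

module Defs where

open import Data.Nat using (ℕ)
import Data.Nat as ℕ
open import Data.Bool using (Bool; true; false; not; _∧_)
open import Data.Product using (Σ; _×_; _,_)
open import Data.Sum using (_⊎_)
open import Relation.Nullary using (Dec; yes; no; ¬_)
open import Relation.Binary.PropositionalEquality using (_≡_; refl; cong; cong₂)

data SenL : Set where
  atom : ℕ → SenL
  neg  : SenL → SenL
  conj : SenL → SenL → SenL

Assignment : Set
Assignment = ℕ → Bool

evalL : Assignment → SenL → Bool
evalL M (atom n)   = M n
evalL M (neg a)    = not (evalL M a)
evalL M (conj a b) = evalL M a ∧ evalL M b

_⊨_ : Assignment → SenL → Set
M ⊨ a = evalL M a ≡ true

_∼_ : SenL → SenL → Set
a ∼ b = ∀ (M : Assignment) → evalL M a ≡ evalL M b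

-- A choice function: picks an element of the (unordered) set {α, β}
record ChoiceFn : Set where
  field
    f       : SenL → SenL → SenL
    f-sym   : ∀ a b → f a b ≡ f b a
    f-elem  : ∀ a b → (f a b ≡ a) ⊎ (f a b ≡ b)
open ChoiceFn public

Regular : ChoiceFn → Set
Regular c = ∀ a a' b → a ∼ a' → f c a b ∼ f c a' b

data SenLs : Set where
  atom : ℕ → SenLs
  neg  : SenLs → SenLs
  conj : SenLs → SenLs → SenLs
  bar  : SenLs → SenLs → SenLs

fbar : ChoiceFn → SenLs → SenL
fbar c (atom n)   = atom n
fbar c (neg φ)    = neg (fbar c φ)
fbar c (conj φ ψ) = conj (fbar c φ) (fbar c ψ)
fbar c (bar φ ψ)  = f c (fbar c φ) (fbar c ψ)

_,_⊨s_ : Assignment → ChoiceFn → SenLs → Set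
M , c ⊨s φ = M ⊨ fbar c φ

_∼[_]_ : SenLs → (ChoiceFn → Set) → SenLs → Set
φ ∼[ X ] ψ = ∀ (M : Assignment) (c : ChoiceFn) → X c →
  ((M , c ⊨s φ → M , c ⊨s ψ) × (M , c ⊨s ψ → M , c ⊨s φ))

data _∈Sub_ : SenLs → SenLs → Set where
  here   : ∀ {φ} → φ ∈Sub φ
  neg    : ∀ {σ φ} → σ ∈Sub φ → σ ∈Sub neg φ
  conjˡ  : ∀ {σ φ ψ} → σ ∈Sub φ → σ ∈Sub conj φ ψ
  conjʳ  : ∀ {σ φ ψ} → σ ∈Sub ψ → σ ∈Sub conj φ ψ
  barˡ   : ∀ {σ φ ψ} → σ ∈Sub φ → σ ∈Sub bar φ ψ
  barʳ   : ∀ {σ φ ψ} → σ ∈Sub ψ → σ ∈Sub bar φ ψ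

_≟s_ : (φ ψ : SenLs) → Dec (φ ≡ ψ)
atom m ≟s atom n with m ℕ.≟ n
... | yes refl = yes refl
... | no ne = no λ { refl → ne refl }
atom _ ≟s neg _ = no λ ()
atom _ ≟s conj _ _ = no λ ()
atom _ ≟s bar _ _ = no λ ()
neg _ ≟s atom _ = no λ ()
neg φ ≟s neg ψ with φ ≟s ψ
... | yes refl = yes refl
... | no ne = no λ { refl → ne refl }
neg _ ≟s conj _ _ = no λ ()
neg _ ≟s bar _ _ = no λ ()
conj _ _ ≟s atom _ = no λ ()
conj _ _ ≟s neg _ = no λ ()
conj φ₁ φ₂ ≟s conj ψ₁ ψ₂ with φ₁ ≟s ψ₁ | φ₂ ≟s ψ₂
... | yes refl | yes refl = yes refl
... | no ne | _ = no λ { refl → ne refl }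
... | yes _ | no ne = no λ { refl → ne refl }
conj _ _ ≟s bar _ _ = no λ ()
bar _ _ ≟s atom _ = no λ ()
bar _ _ ≟s neg _ = no λ ()
bar _ _ ≟s conj _ _ = no λ ()
bar φ₁ φ₂ ≟s bar ψ₁ ψ₂ with φ₁ ≟s ψ₁ | φ₂ ≟s ψ₂
... | yes refl | yes refl = yes refl
... | no ne | _ = no λ { refl → ne refl }
... | yes _ | no ne = no λ { refl → ne refl }

_[_/_] : SenLs → SenLs → SenLs → SenLs
φ [ σ' / σ ] with φ ≟s σ
... | yes _ = σ'
φ [ σ' / σ ] | no _ = go φ
  where
  go : SenLs → SenLs
  go (atom n)   = atom n
  go (neg φ)    = neg (φ [ σ' / σ ])
  go (conj φ ψ) = conj (φ [ σ' / σ ]) (ψ [ σ' / σ ])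
  go (bar φ ψ)  = bar (φ [ σ' / σ ]) (ψ [ σ' / σ ])

LogicallyClosed : (ChoiceFn → Set) → Set
LogicallyClosed X = ∀ (φ σ σ' : SenLs) → σ ∈Sub φ →
  σ ∼[ X ] σ' → φ ∼[ X ] (φ [ σ' / σ ])

{-# OPTIONS --safe #-}
-- If f is regular, f̄ maps ∼-equivalent arguments of | to ∼-equivalent sentences, so
-- f̄(φ) ∼ f̄(φ[σ'/σ]) by induction on φ. Conversely, given α ∼ α' and β, pad α with
-- double negations until it is longer than β; then α occurs in α|β only as the left
-- argument, and closure under replacing it by α' gives f(α,β) ∼ f(α',β).
module Submission where

open import Defs
open import Data.Bool using (not; _∧_)
open import Data.Bool.Properties using (not-involutive; ⇔→≡)
open import Data.Nat using (ℕ; zero; suc; _+_; _<_; z≤n; s≤s)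
open import Data.Nat.Properties using (<-irrefl; <-trans; <-≤-trans; <⇒≤; n<1+n; m≤m+n; m≤n+m)
open import Data.Product using (Σ; _,_; proj₁; proj₂)
open import Data.Empty using (⊥-elim)
open import Function.Bundles using (_⇔_; mk⇔; Equivalence)
open import Relation.Nullary using (yes; no)
open import Relation.Binary.PropositionalEquality

∼[]⇔fbar-∼ : ∀ {X φ ψ} → φ ∼[ X ] ψ ⇔ (∀ c → X c → fbar c φ ∼ fbar c ψ)
∼[]⇔fbar-∼ = mk⇔
  (λ h c xc M → ⇔→≡ (mk⇔ (proj₁ (h M c xc)) (proj₂ (h M c xc))))
  (λ h M c xc → trans (sym (h c xc M)) , trans (h c xc M))

module _ (c : ChoiceFn) (reg : Regular c) where

  Regular⇒f-cong : ∀ {a a' b b'} → a ∼ a' → b ∼ b' → f c a b ∼ f c a' b'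
  Regular⇒f-cong {a} {a'} {b} {b'} a∼a' b∼b' M = begin
    evalL M (f c a b)   ≡⟨ reg a a' b a∼a' M ⟩
    evalL M (f c a' b)  ≡⟨ cong (evalL M) (f-sym c a' b) ⟩
    evalL M (f c b a')  ≡⟨ reg b b' a' b∼b' M ⟩
    evalL M (f c b' a') ≡⟨ cong (evalL M) (f-sym c b' a') ⟩
    evalL M (f c a' b') ∎
    where open ≡-Reasoning

  Regular⇒fbar-[/]-cong : ∀ {σ σ'} → fbar c σ ∼ fbar c σ' →
                          ∀ φ → fbar c φ ∼ fbar c (φ [ σ' / σ ])
  Regular⇒fbar-[/]-cong {σ} σ∼σ' φ with φ ≟s σ
  ... | yes refl = σ∼σ'
  Regular⇒fbar-[/]-cong σ∼σ' (atom n)   | no _ = λ M → refl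
  Regular⇒fbar-[/]-cong σ∼σ' (neg φ)    | no _ =
    λ M → cong not (Regular⇒fbar-[/]-cong σ∼σ' φ M)
  Regular⇒fbar-[/]-cong σ∼σ' (conj φ ψ) | no _ =
    λ M → cong₂ _∧_ (Regular⇒fbar-[/]-cong σ∼σ' φ M) (Regular⇒fbar-[/]-cong σ∼σ' ψ M)
  Regular⇒fbar-[/]-cong σ∼σ' (bar φ ψ)  | no _ =
    Regular⇒f-cong (Regular⇒fbar-[/]-cong σ∼σ' φ) (Regular⇒fbar-[/]-cong σ∼σ' ψ)

Regular⇒LogicallyClosed : ∀ X → (∀ c → X c → Regular c) → LogicallyClosed X
Regular⇒LogicallyClosed X reg φ σ σ' _ σ∼σ' =
  Equivalence.from (∼[]⇔fbar-∼ {φ = φ} {φ [ σ' / σ ]}) λ c xc →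
    Regular⇒fbar-[/]-cong c (reg c xc) (Equivalence.to (∼[]⇔fbar-∼ {φ = σ} {σ'}) σ∼σ' c xc) φ

emb : SenL → SenLs
emb (atom n)   = atom n
emb (neg a)    = neg (emb a)
emb (conj a b) = conj (emb a) (emb b)

fbar-emb : ∀ c a → fbar c (emb a) ≡ a
fbar-emb c (atom n)   = refl
fbar-emb c (neg a)    = cong neg (fbar-emb c a)
fbar-emb c (conj a b) = cong₂ conj (fbar-emb c a) (fbar-emb c b)

size : SenLs → ℕ
size (atom _)   = 1
size (neg φ)    = suc (size φ)
size (conj φ ψ) = suc (size φ + size ψ)
size (bar φ ψ)  = suc (size φ + size ψ)

size-positive : ∀ φ → 0 < size φ
size-positive (atom _)   = s≤s z≤n
size-positive (neg _)    = s≤s z≤n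
size-positive (conj _ _) = s≤s z≤n
size-positive (bar _ _)  = s≤s z≤n

[/]-self : ∀ σ σ' → σ [ σ' / σ ] ≡ σ'
[/]-self σ σ' with σ ≟s σ
... | yes _ = refl
... | no σ≢σ = ⊥-elim (σ≢σ refl)

[/]-fresh : ∀ {σ σ'} φ → size φ < size σ → φ [ σ' / σ ] ≡ φ
[/]-fresh {σ} φ lt with φ ≟s σ
... | yes refl = ⊥-elim (<-irrefl refl lt)
[/]-fresh (atom n)   lt | no _ = refl
[/]-fresh (neg φ)    lt | no _ = cong neg ([/]-fresh φ (<-trans (n<1+n _) lt))
[/]-fresh (conj φ ψ) lt | no _ = cong₂ conj
  ([/]-fresh φ (<-≤-trans (s≤s (m≤m+n _ _)) (<⇒≤ lt)))
  ([/]-fresh ψ (<-≤-trans (s≤s (m≤n+m _ _)) (<⇒≤ lt)))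
[/]-fresh (bar φ ψ)  lt | no _ = cong₂ bar
  ([/]-fresh φ (<-≤-trans (s≤s (m≤m+n _ _)) (<⇒≤ lt)))
  ([/]-fresh ψ (<-≤-trans (s≤s (m≤n+m _ _)) (<⇒≤ lt)))

bar-[/]-emb : ∀ φ ψ σ' a → bar φ ψ [ σ' / emb a ] ≡ bar (φ [ σ' / emb a ]) (ψ [ σ' / emb a ])
bar-[/]-emb φ ψ σ' (atom _)   = refl
bar-[/]-emb φ ψ σ' (neg _)    = refl
bar-[/]-emb φ ψ σ' (conj _ _) = refl

LogicallyClosed⇒f-congˡ-long : ∀ {X c} → LogicallyClosed X → X c →
  ∀ {a a'} b → size (emb b) < size (emb a) → a ∼ a' → f c a b ∼ f c a' b
LogicallyClosed⇒f-congˡ-long {X} {c} closed xc {a} {a'} b short a∼a' =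
  subst₂ _∼_
    (cong₂ (f c) (fbar-emb c a) (fbar-emb c b))
    (cong₂ (f c) (fbar-emb c a') (fbar-emb c b))
    (Equivalence.to (∼[]⇔fbar-∼ {φ = bar (emb a) (emb b)} {bar (emb a') (emb b)}) replaced c xc)
  where
  emb-a∼emb-a' : emb a ∼[ X ] emb a'
  emb-a∼emb-a' = Equivalence.from (∼[]⇔fbar-∼ {φ = emb a} {emb a'}) λ c' _ M →
    trans (cong (evalL M) (fbar-emb c' a))
          (trans (a∼a' M) (sym (cong (evalL M) (fbar-emb c' a'))))

  bar-[/] : bar (emb a) (emb b) [ emb a' / emb a ] ≡ bar (emb a') (emb b)
  bar-[/] = trans (bar-[/]-emb (emb a) (emb b) (emb a') a)
                  (cong₂ bar ([/]-self (emb a) (emb a')) ([/]-fresh (emb b) short))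

  replaced : bar (emb a) (emb b) ∼[ X ] bar (emb a') (emb b)
  replaced = subst (bar (emb a) (emb b) ∼[ X ]_) bar-[/]
    (closed (bar (emb a) (emb b)) (emb a) (emb a') (barˡ here) emb-a∼emb-a')

¬¬^ : ℕ → SenL → SenL
¬¬^ zero    a = a
¬¬^ (suc n) a = neg (neg (¬¬^ n a))

¬¬^-∼ : ∀ n a → ¬¬^ n a ∼ a
¬¬^-∼ zero    a M = refl
¬¬^-∼ (suc n) a M = trans (not-involutive _) (¬¬^-∼ n a M)

size-¬¬^ : ∀ n a → n < size (emb (¬¬^ n a))
size-¬¬^ zero    a = size-positive (emb a)
size-¬¬^ (suc n) a = s≤s (<-trans (size-¬¬^ n a) (n<1+n _))

LogicallyClosed⇒Regular : ∀ X → LogicallyClosed X → ∀ c → X c → Regular c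
LogicallyClosed⇒Regular X closed c xc a a' b a∼a' M =
  trans (sym (congˡ a (¬¬^-∼ n a) M)) (congˡ a' (λ M' → trans (¬¬^-∼ n a M') (a∼a' M')) M)
  where
  n : ℕ
  n = size (emb b)
  congˡ : ∀ t → ¬¬^ n a ∼ t → f c (¬¬^ n a) b ∼ f c t b
  congˡ _ = LogicallyClosed⇒f-congˡ-long closed xc b (size-¬¬^ n a)

theorem2p28 : (X : ChoiceFn → Set) → Σ ChoiceFn X →
    (LogicallyClosed X ⇔ (∀ (c : ChoiceFn) → X c → Regular c))
theorem2p28 X _ = mk⇔ (LogicallyClosed⇒Regular X) (Regular⇒LogicallyClosed X)
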